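{- Let $G,H$ be finite graphs and $k,\ell$ nonnegative integers such that $\iota_k(G)$ and $\iota_\ell(H)$ are defined. Then $\iota_k(G)\,\iota_\ell(H)\le \iota_{k+\ell}(G\,\square\, H)$.
   Context: For a graph $G=(V,E)$ and a nonnegative integer $k$, the $k$-imbalance is $\iota_k(G)=\max\{|A|-|B| \mid V=A\sqcup B,\ \Delta(G[A])\le k,\ \Delta(G[B])\le k\}$, where $\Delta$ denotes maximum degree and $G[A]$ the induced subgraph (it is defined when at least one such partition exists; it is then nonnegative). The Cartesian product $G\square H$ of $G=(V,E)$ and $H=(V',E')$ has vertex set $V\times V'$, with $\{(u,u'),(v,v')\}$ an edge iff either $u=v$ and $\{u',v'\}\in E'$, or $u'=v'$ and $\{u,v\}\in E$. -}

module Defs where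

open import Data.Bool using (Bool; true; false; if_then_else_; _∧_; _∨_; not)
open import Data.Bool.Properties using () renaming (_≟_ to _≟ᵇ_)
open import Data.Nat using (ℕ; _≤_)
open import Data.Fin using (Fin; remQuot; _≟_)
open import Data.List using (List; length; filter; allFin)
open import Data.Integer as ℤ using (ℤ; _-_; +_)
open import Data.Product using (Σ; _×_; _,_; proj₁; proj₂)
open import Relation.Binary.PropositionalEquality using (_≡_; refl; sym; cong₂)
open import Data.Empty using (⊥-elim)
import Data.Bool.Properties
open import Relation.Nullary using (does; yes; no)
open import Relation.Nullary.Decidable using (⌊_⌋)
open import Function using (_∘_)

record Graph : Set where
  field
    n       : ℕ
    adj     : Fin n → Fin n → Bool
    adj-sym : ∀ u v → adj u v ≡ adj v u
    adj-irr : ∀ v → adj v v ≡ false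
open Graph public

-- A 2-partition V = A ⊔ B is a function side : V → Bool (true = A, false = B).
Partition : Graph → Set
Partition G = Fin (n G) → Bool

sideDeg : (G : Graph) → Partition G → Fin (n G) → ℕ
sideDeg G s v = length (filter (λ w → (adj G v w ∧ ⌊ s w ≟ᵇ s v ⌋) ≟ᵇ true) (allFin (n G)))

Valid : (G : Graph) → ℕ → Partition G → Set
Valid G k s = ∀ v → sideDeg G s v ≤ k

sizeA sizeB : (G : Graph) → Partition G → ℕ
sizeA G s = length (filter (λ v → s v ≟ᵇ true) (allFin (n G)))
sizeB G s = length (filter (λ v → s v ≟ᵇ false) (allFin (n G)))

diff : (G : Graph) → Partition G → ℤ
diff G s = + sizeA G s - + sizeB G s

IsImbalance : Graph → ℕ → ℤ → Set
IsImbalance G k m =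
  (Σ (Partition G) λ s → Valid G k s × diff G s ≡ m) ×
  (∀ s → Valid G k s → diff G s ℤ.≤ m)

pairAdj : (G H : Graph) → Fin (n G) × Fin (n H) → Fin (n G) × Fin (n H) → Bool
pairAdj G H (u , u') (v , v') =
  (⌊ u ≟ v ⌋ ∧ adj H u' v') ∨ (⌊ u' ≟ v' ⌋ ∧ adj G u v)

□-adj : (G H : Graph) → Fin (n G Data.Nat.* n H) → Fin (n G Data.Nat.* n H) → Bool
□-adj G H x y = pairAdj G H (remQuot (n H) x) (remQuot (n H) y)

private
  ⌊≟⌋-sym : ∀ {m} (a b : Fin m) → ⌊ a ≟ b ⌋ ≡ ⌊ b ≟ a ⌋
  ⌊≟⌋-sym a b with a ≟ b | b ≟ a
  ... | yes _ | yes _ = refl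
  ... | no _  | no _  = refl
  ... | yes p | no q  = ⊥-elim (q (sym p))
  ... | no p  | yes q = ⊥-elim (p (sym q))

  ⌊≟⌋-refl : ∀ {m} (a : Fin m) → ⌊ a ≟ a ⌋ ≡ true
  ⌊≟⌋-refl a with a ≟ a
  ... | yes _ = refl
  ... | no p  = ⊥-elim (p refl)

□-sym : (G H : Graph) → ∀ x y → □-adj G H x y ≡ □-adj G H y x
□-sym G H x y = pair-sym (remQuot (n H) x) (remQuot (n H) y)
  where
  pair-sym : ∀ p q → pairAdj G H p q ≡ pairAdj G H q p
  pair-sym (u , u') (v , v') =
    cong₂ _∨_ (cong₂ _∧_ (⌊≟⌋-sym u v) (adj-sym H u' v'))
              (cong₂ _∧_ (⌊≟⌋-sym u' v') (adj-sym G u v))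

□-irr : (G H : Graph) → ∀ x → □-adj G H x x ≡ false
□-irr G H x = pair-irr (remQuot (n H) x)
  where
  pair-irr : ∀ p → pairAdj G H p p ≡ false
  pair-irr (u , u') rewrite adj-irr H u' | adj-irr G u
    | Data.Bool.Properties.∧-zeroʳ ⌊ u ≟ u ⌋
    | Data.Bool.Properties.∧-zeroʳ ⌊ u' ≟ u' ⌋ = refl

_□_ : Graph → Graph → Graph
G □ H = record
  { n = n G Data.Nat.* n H
  ; adj = □-adj G H
  ; adj-sym = □-sym G H
  ; adj-irr = □-irr G H
  }

{-# OPTIONS --safe #-}

-- Given partitions sG and sH attaining ιG and ιH, put (u , u′) on side A of
-- G □ H exactly when sG u = sH u′. Counting A as +1 and B as −1, the sign of
-- (u , u′) is the product of the signs of u and u′, so the imbalance of this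
-- partition is ιG · ιH. A neighbour of (u , u′) differs in one coordinate only,
-- and it is on the same side iff that coordinate is: same-side degrees add, so
-- the partition is a (k + ℓ)-partition. Partitions of a finite vertex set can
-- be enumerated, so ι_{k+ℓ}(G □ H) exists and is at least ιG · ιH.

module Submission where

open import Defs
open import Data.Nat using (ℕ; _+_)
open import Data.Integer using (ℤ; _*_; _≤_)
open import Data.Product using (Σ; _×_)

open import Data.Bool using (Bool; true; false; _∧_; _∨_)
open import Data.Bool.Properties using (∨-identityʳ) renaming (_≟_ to _≟ᵇ_)
open import Data.Fin using (Fin; zero; suc; remQuot; _↑ˡ_; _↑ʳ_) renaming (_≟_ to _≟ᶠ_)
open import Data.Fin.Properties using (splitAt-↑ˡ; splitAt-↑ʳ; all?)
import Data.Integer as ℤ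
open import Data.Integer using (+_; 0ℤ; 1ℤ; -1ℤ; -_; _-_)
open import Data.Integer.Properties
  using ( +-*-semiring; ≤-totalOrder; +-assoc; +-identityˡ; +-identityʳ; *-identityˡ
        ; +-injective; -1*i≡-i)
open import Data.List using (List; []; _∷_; length; filter; tabulate; map; _++_)
open import Data.List.Extrema ≤-totalOrder using (argmax; argmax-all; f[xs]≤f[argmax])
open import Data.List.Relation.Unary.Any using (here)
open import Data.List.Membership.Propositional using (_∈_)
open import Data.List.Membership.Propositional.Properties
  using (∈-++⁺ˡ; ∈-++⁺ʳ; ∈-map⁺; ∈-filter⁺)
import Data.List.Relation.Unary.All as All
open import Data.List.Relation.Unary.All.Properties using (all-filter)
import Data.Nat as ℕ
open import Data.Nat.Properties using (+-mono-≤)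
open import Data.Product using (_,_; proj₁; proj₂; map₁)
open import Data.Vec.Functional as Vector using (Vector)
open import Function using (_∘_; id)
open import Level using (0ℓ)
open import Relation.Binary.Core using (_Preserves_⟶_)
open import Relation.Binary.Definitions using (_Respects_)
open import Relation.Binary.PropositionalEquality
open import Relation.Nullary using (does; yes; no)
open import Relation.Nullary.Decidable using (⌊_⌋)
open import Relation.Unary using (Pred; Decidable)

open import Algebra.Properties.Semiring.Sum +-*-semiring
  using (sum; sum-syntax; sum-cong-≗; sum-replicate-zero; ∑-distrib-+; *-distribˡ-sum; *-distribʳ-sum)

open ≡-Reasoning

∑-splitAt : ∀ m n (f : Fin (m ℕ.+ n) → ℤ) →
  ∑[ i < m ℕ.+ n ] f i ≡ ∑[ i < m ] f (i ↑ˡ n) ℤ.+ ∑[ j < n ] f (m ↑ʳ j)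
∑-splitAt ℕ.zero    n f = sym (+-identityˡ _)
∑-splitAt (ℕ.suc m) n f = trans (cong (λ z → f zero ℤ.+ z) (∑-splitAt m n (f ∘ suc)))
  (sym (+-assoc (f zero) _ _))

∑-remQuot : ∀ m n (g : Fin m × Fin n → ℤ) →
  ∑[ x < m ℕ.* n ] g (remQuot {m} n x) ≡ ∑[ i < m ] ∑[ j < n ] g (i , j)
∑-remQuot ℕ.zero    n g = refl
∑-remQuot (ℕ.suc m) n g = begin
  ∑[ x < n ℕ.+ m ℕ.* n ] g (remQuot {ℕ.suc m} n x)
    ≡⟨ ∑-splitAt n (m ℕ.* n) _ ⟩
  ∑[ j < n ] g (remQuot {ℕ.suc m} n (j ↑ˡ m ℕ.* n))
    ℤ.+ ∑[ x < m ℕ.* n ] g (remQuot {ℕ.suc m} n (n ↑ʳ x))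
    ≡⟨ cong₂ ℤ._+_ (sum-cong-≗ (cong g ∘ remQuot-↑ˡ)) (sum-cong-≗ (cong g ∘ remQuot-↑ʳ)) ⟩
  ∑[ j < n ] g (zero , j) ℤ.+ ∑[ x < m ℕ.* n ] g (map₁ suc (remQuot {m} n x))
    ≡⟨ cong (λ z → ∑[ j < n ] g (zero , j) ℤ.+ z) (∑-remQuot m n (g ∘ map₁ suc)) ⟩
  ∑[ i < ℕ.suc m ] ∑[ j < n ] g (i , j) ∎
  where
  remQuot-↑ˡ : ∀ j → remQuot {ℕ.suc m} n (j ↑ˡ m ℕ.* n) ≡ (zero , j)
  remQuot-↑ˡ j rewrite splitAt-↑ˡ n j (m ℕ.* n) = refl
  remQuot-↑ʳ : ∀ x → remQuot {ℕ.suc m} n (n ↑ʳ x) ≡ map₁ suc (remQuot {m} n x)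
  remQuot-↑ʳ x rewrite splitAt-↑ʳ n (m ℕ.* n) x = refl

𝟙 : Bool → ℤ
𝟙 true  = 1ℤ
𝟙 false = 0ℤ

δ : ∀ {n} → Fin n → Fin n → ℤ
δ u v = 𝟙 ⌊ u ≟ᶠ v ⌋

∑-δ-* : ∀ {n} (u : Fin n) c → ∑[ v < n ] (δ u v * c) ≡ c
∑-δ-* {ℕ.suc n} zero c = begin
  1ℤ * c ℤ.+ ∑[ v < n ] (0ℤ * c) ≡⟨ cong₂ ℤ._+_ (*-identityˡ c) (sum-replicate-zero n) ⟩
  c ℤ.+ 0ℤ                       ≡⟨ +-identityʳ c ⟩
  c                              ∎
∑-δ-* {ℕ.suc n} (suc u) c = trans (+-identityˡ _) (trans (sum-cong-≗ δ-suc) (∑-δ-* u c))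
  where
  δ-suc : ∀ v → δ (suc u) (suc v) * c ≡ δ u v * c
  δ-suc v with u ≟ᶠ v
  ... | yes _ = refl
  ... | no  _ = refl

∑-distrib-- : ∀ {n} (f g : Vector ℤ n) → ∑[ i < n ] (f i - g i) ≡ sum f - sum g
∑-distrib-- {n} f g = begin
  ∑[ i < n ] (f i ℤ.+ - g i)         ≡⟨ ∑-distrib-+ f (-_ ∘ g) ⟩
  sum f ℤ.+ sum (-_ ∘ g)             ≡˘⟨ cong (λ z → sum f ℤ.+ z) (sum-cong-≗ (-1*i≡-i ∘ g)) ⟩
  sum f ℤ.+ ∑[ i < n ] (-1ℤ * g i)   ≡˘⟨ cong (λ z → sum f ℤ.+ z) (*-distribˡ-sum -1ℤ g) ⟩
  sum f ℤ.+ -1ℤ * sum g             ≡⟨ cong (λ z → sum f ℤ.+ z) (-1*i≡-i (sum g)) ⟩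
  sum f - sum g                     ∎

∣filter-tabulate∣ : ∀ {A : Set} {P : Pred A 0ℓ} (P? : Decidable P) {n} (g : Fin n → A) →
  + length (filter P? (tabulate g)) ≡ ∑[ i < n ] 𝟙 (does (P? (g i)))
∣filter-tabulate∣ P? {ℕ.zero}  g = refl
∣filter-tabulate∣ P? {ℕ.suc n} g with does (P? (g zero))
... | true  = cong (λ z → 1ℤ ℤ.+ z) (∣filter-tabulate∣ P? (g ∘ suc))
... | false = trans (∣filter-tabulate∣ P? (g ∘ suc)) (sym (+-identityˡ _))

sgn : Bool → ℤ
sgn true  = 1ℤ
sgn false = -1ℤ

sgn-≟ : ∀ a b → sgn ⌊ a ≟ᵇ b ⌋ ≡ sgn a * sgn b
sgn-≟ true  true  = refl
sgn-≟ true  false = refl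
sgn-≟ false true  = refl
sgn-≟ false false = refl

diff≡∑sgn : (G : Graph) (s : Partition G) → diff G s ≡ ∑[ v < n G ] sgn (s v)
diff≡∑sgn G s = begin
  + sizeA G s - + sizeB G s
    ≡⟨ cong₂ _-_ (∣filter-tabulate∣ _ {n G} id) (∣filter-tabulate∣ _ {n G} id) ⟩
  ∑[ v < n G ] 𝟙 (does (s v ≟ᵇ true)) - ∑[ v < n G ] 𝟙 (does (s v ≟ᵇ false))
    ≡˘⟨ ∑-distrib-- (λ v → 𝟙 (does (s v ≟ᵇ true))) (λ v → 𝟙 (does (s v ≟ᵇ false))) ⟩
  ∑[ v < n G ] (𝟙 (does (s v ≟ᵇ true)) - 𝟙 (does (s v ≟ᵇ false)))
    ≡⟨ sum-cong-≗ (sgn-as-𝟙 ∘ s) ⟩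
  ∑[ v < n G ] sgn (s v) ∎
  where
  sgn-as-𝟙 : ∀ b → 𝟙 (does (b ≟ᵇ true)) - 𝟙 (does (b ≟ᵇ false)) ≡ sgn b
  sgn-as-𝟙 true  = refl
  sgn-as-𝟙 false = refl

adjSameSide : (G : Graph) → Partition G → Fin (n G) → Fin (n G) → Bool
adjSameSide G s v w = adj G v w ∧ ⌊ s w ≟ᵇ s v ⌋

sideDeg≡∑ : (G : Graph) (s : Partition G) (v : Fin (n G)) →
  + sideDeg G s v ≡ ∑[ w < n G ] 𝟙 (adjSameSide G s v w)
sideDeg≡∑ G s v =
  trans (∣filter-tabulate∣ _ {n G} id) (sum-cong-≗ (cong 𝟙 ∘ does-≟true ∘ adjSameSide G s v))
  where
  does-≟true : ∀ b → does (b ≟ᵇ true) ≡ b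
  does-≟true true  = refl
  does-≟true false = refl

sideDeg-cong : (G : Graph) {s t : Partition G} → s ≗ t → ∀ v → sideDeg G s v ≡ sideDeg G t v
sideDeg-cong G {s} {t} s≗t v = +-injective (begin
  + sideDeg G s v                       ≡⟨ sideDeg≡∑ G s v ⟩
  ∑[ w < n G ] 𝟙 (adjSameSide G s v w)  ≡⟨ sum-cong-≗ (λ w → cong₂ (sameSide w) (s≗t w) (s≗t v)) ⟩
  ∑[ w < n G ] 𝟙 (adjSameSide G t v w)  ≡˘⟨ sideDeg≡∑ G t v ⟩
  + sideDeg G t v                       ∎)
  where
  sameSide : Fin (n G) → Bool → Bool → ℤ
  sameSide w a b = 𝟙 (adj G v w ∧ ⌊ a ≟ᵇ b ⌋)

Valid-resp : (G : Graph) (k : ℕ) → Valid G k Respects _≗_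
Valid-resp G k s≗t valid v = subst (ℕ._≤ k) (sideDeg-cong G s≗t v) (valid v)

diff-cong : (G : Graph) → diff G Preserves _≗_ ⟶ _≡_
diff-cong G {s} {t} s≗t = begin
  diff G s                  ≡⟨ diff≡∑sgn G s ⟩
  ∑[ v < n G ] sgn (s v)    ≡⟨ sum-cong-≗ (cong sgn ∘ s≗t) ⟩
  ∑[ v < n G ] sgn (t v)    ≡˘⟨ diff≡∑sgn G t ⟩
  diff G t                  ∎

Valid? : (G : Graph) (k : ℕ) → Decidable (Valid G k)
Valid? G k s = all? (λ v → sideDeg G s v ℕ.≤? k)

allVectors : ∀ n → List (Vector Bool n)
allVectors ℕ.zero    = Vector.[] ∷ []
allVectors (ℕ.suc n) = map (true Vector.∷_) (allVectors n) ++ map (false Vector.∷_) (allVectors n)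

∷-∈-allVectors : ∀ {n} b {t : Vector Bool n} → t ∈ allVectors n → (b Vector.∷ t) ∈ allVectors (ℕ.suc n)
∷-∈-allVectors true  t∈ = ∈-++⁺ˡ (∈-map⁺ (true Vector.∷_) t∈)
∷-∈-allVectors false t∈ = ∈-++⁺ʳ (map (true Vector.∷_) _) (∈-map⁺ (false Vector.∷_) t∈)

-- Without function extensionality, completeness only holds up to ≗.
allVectors-complete : ∀ {n} (s : Vector Bool n) → Σ (Vector Bool n) λ t → t ∈ allVectors n × t ≗ s
allVectors-complete {ℕ.zero}  s = Vector.[] , here refl , λ ()
allVectors-complete {ℕ.suc n} s =
  let (t , t∈ , t≗s) = allVectors-complete (s ∘ suc)
  in s zero Vector.∷ t , ∷-∈-allVectors (s zero) t∈ , λ { zero → refl ; (suc i) → t≗s i }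

module _ {n} {P : Pred (Vector Bool n) 0ℓ} (P? : Decidable P) (P-resp : P Respects _≗_)
         (f : Vector Bool n → ℤ) (f-cong : f Preserves _≗_ ⟶ _≡_) where

  ∃-argmax : ∀ {s₀} → P s₀ → Σ (Vector Bool n) λ t → P t × (∀ s → P s → f s ≤ f t)
  ∃-argmax {s₀} Ps₀ = t , argmax-all f Ps₀ (all-filter P? (allVectors n)) , f≤f[t]
    where
    candidates : List (Vector Bool n)
    candidates = filter P? (allVectors n)
    t : Vector Bool n
    t = argmax f s₀ candidates
    f≤f[t] : ∀ s → P s → f s ≤ f t
    f≤f[t] s Ps =
      let (t′ , t′∈ , t′≗s) = allVectors-complete s
          t′∈candidates = ∈-filter⁺ P? t′∈ (P-resp (sym ∘ t′≗s) Ps)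
      in subst (_≤ f t) (f-cong t′≗s) (All.lookup (f[xs]≤f[argmax] {f = f} s₀ candidates) t′∈candidates)

imbalance-exists : (G : Graph) (k : ℕ) {s₀ : Partition G} → Valid G k s₀ →
  Σ ℤ λ ι → IsImbalance G k ι × diff G s₀ ≤ ι
imbalance-exists G k valid₀ with ∃-argmax (Valid? G k) (Valid-resp G k) (diff G) (diff-cong G) valid₀
... | t , valid , maximal = diff G t , ((t , valid , refl) , maximal) , maximal _ valid₀

⌊≟⌋-cancelˡ : ∀ a b c → ⌊ ⌊ a ≟ᵇ b ⌋ ≟ᵇ ⌊ a ≟ᵇ c ⌋ ⌋ ≡ ⌊ b ≟ᵇ c ⌋
⌊≟⌋-cancelˡ true  true  true  = refl
⌊≟⌋-cancelˡ true  true  false = refl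
⌊≟⌋-cancelˡ true  false true  = refl
⌊≟⌋-cancelˡ true  false false = refl
⌊≟⌋-cancelˡ false true  true  = refl
⌊≟⌋-cancelˡ false true  false = refl
⌊≟⌋-cancelˡ false false true  = refl
⌊≟⌋-cancelˡ false false false = refl

⌊≟⌋-cancelʳ : ∀ a b c → ⌊ ⌊ b ≟ᵇ a ⌋ ≟ᵇ ⌊ c ≟ᵇ a ⌋ ⌋ ≡ ⌊ b ≟ᵇ c ⌋
⌊≟⌋-cancelʳ true  true  true  = refl
⌊≟⌋-cancelʳ true  true  false = refl
⌊≟⌋-cancelʳ true  false true  = refl
⌊≟⌋-cancelʳ true  false false = refl
⌊≟⌋-cancelʳ false true  true  = refl
⌊≟⌋-cancelʳ false true  false = refl
⌊≟⌋-cancelʳ false false true  = refl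
⌊≟⌋-cancelʳ false false false = refl

module _ (G H : Graph) (sG : Partition G) (sH : Partition H) where

  productSide : Fin (n G) × Fin (n H) → Bool
  productSide (u , u′) = ⌊ sG u ≟ᵇ sH u′ ⌋

  productPartition : Partition (G □ H)
  productPartition x = productSide (remQuot {n G} (n H) x)

  diff-productPartition : diff (G □ H) productPartition ≡ diff G sG * diff H sH
  diff-productPartition = begin
    diff (G □ H) productPartition
      ≡⟨ diff≡∑sgn (G □ H) productPartition ⟩
    ∑[ x < n G ℕ.* n H ] sgn (productSide (remQuot {n G} (n H) x))
      ≡⟨ ∑-remQuot (n G) (n H) (sgn ∘ productSide) ⟩
    ∑[ u < n G ] ∑[ u′ < n H ] sgn ⌊ sG u ≟ᵇ sH u′ ⌋
      ≡⟨ sum-cong-≗ (λ u → sum-cong-≗ (λ u′ → sgn-≟ (sG u) (sH u′))) ⟩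
    ∑[ u < n G ] ∑[ u′ < n H ] (sgn (sG u) * sgn (sH u′))
      ≡˘⟨ sum-cong-≗ (λ u → *-distribˡ-sum (sgn (sG u)) (sgn ∘ sH)) ⟩
    ∑[ u < n G ] (sgn (sG u) * ∑[ u′ < n H ] sgn (sH u′))
      ≡˘⟨ *-distribʳ-sum _ (sgn ∘ sG) ⟩
    ∑[ u < n G ] sgn (sG u) * ∑[ u′ < n H ] sgn (sH u′)
      ≡˘⟨ cong₂ _*_ (diff≡∑sgn G sG) (diff≡∑sgn H sH) ⟩
    diff G sG * diff H sH ∎

  adjSameSide-productSide : ∀ u u′ v v′ →
    𝟙 (pairAdj G H (u , u′) (v , v′) ∧ ⌊ productSide (v , v′) ≟ᵇ productSide (u , u′) ⌋)
      ≡ δ u′ v′ * 𝟙 (adjSameSide G sG u v) ℤ.+ δ u v * 𝟙 (adjSameSide H sH u′ v′)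
  adjSameSide-productSide u u′ v v′ with u ≟ᶠ v | u′ ≟ᶠ v′
  ... | yes refl | yes refl rewrite adj-irr G u | adj-irr H u′ = refl
  ... | yes refl | no _ = begin
    𝟙 ((adj H u′ v′ ∨ false) ∧ ⌊ ⌊ sG u ≟ᵇ sH v′ ⌋ ≟ᵇ ⌊ sG u ≟ᵇ sH u′ ⌋ ⌋)
      ≡⟨ cong₂ (λ a b → 𝟙 (a ∧ b)) (∨-identityʳ _) (⌊≟⌋-cancelˡ (sG u) (sH v′) (sH u′)) ⟩
    𝟙 (adjSameSide H sH u′ v′)
      ≡˘⟨ trans (+-identityˡ _) (*-identityˡ _) ⟩
    0ℤ ℤ.+ 1ℤ * 𝟙 (adjSameSide H sH u′ v′) ∎
  ... | no _ | yes refl = begin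
    𝟙 (adj G u v ∧ ⌊ ⌊ sG v ≟ᵇ sH u′ ⌋ ≟ᵇ ⌊ sG u ≟ᵇ sH u′ ⌋ ⌋)
      ≡⟨ cong (λ b → 𝟙 (adj G u v ∧ b)) (⌊≟⌋-cancelʳ (sH u′) (sG v) (sG u)) ⟩
    𝟙 (adjSameSide G sG u v)
      ≡˘⟨ trans (+-identityʳ _) (*-identityˡ _) ⟩
    1ℤ * 𝟙 (adjSameSide G sG u v) ℤ.+ 0ℤ ∎
  ... | no _ | no _ = refl

  sideDeg-productPartition : ∀ x →
    sideDeg (G □ H) productPartition x
      ≡ sideDeg G sG (proj₁ (remQuot {n G} (n H) x)) + sideDeg H sH (proj₂ (remQuot {n G} (n H) x))
  sideDeg-productPartition x = +-injective (begin
    + sideDeg (G □ H) productPartition x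
      ≡⟨ sideDeg≡∑ (G □ H) productPartition x ⟩
    ∑[ y < n G ℕ.* n H ] 𝟙 (adjSameSide-at (remQuot {n G} (n H) y))
      ≡⟨ ∑-remQuot (n G) (n H) (𝟙 ∘ adjSameSide-at) ⟩
    ∑[ v < n G ] ∑[ v′ < n H ] 𝟙 (adjSameSide-at (v , v′))
      ≡⟨ sum-cong-≗ (λ v → sum-cong-≗ (adjSameSide-productSide u u′ v)) ⟩
    ∑[ v < n G ] ∑[ v′ < n H ] (δ u′ v′ * 𝟙G v ℤ.+ δ u v * 𝟙H v′)
      ≡⟨ sum-cong-≗ (λ v → ∑-distrib-+ (λ v′ → δ u′ v′ * 𝟙G v) (λ v′ → δ u v * 𝟙H v′)) ⟩
    ∑[ v < n G ] (∑[ v′ < n H ] (δ u′ v′ * 𝟙G v) ℤ.+ ∑[ v′ < n H ] (δ u v * 𝟙H v′))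
      ≡⟨ sum-cong-≗ (λ v → cong₂ ℤ._+_ (∑-δ-* u′ (𝟙G v)) (sym (*-distribˡ-sum (δ u v) 𝟙H))) ⟩
    ∑[ v < n G ] (𝟙G v ℤ.+ δ u v * sum 𝟙H)
      ≡⟨ ∑-distrib-+ 𝟙G (λ v → δ u v * sum 𝟙H) ⟩
    sum 𝟙G ℤ.+ ∑[ v < n G ] (δ u v * sum 𝟙H)
      ≡⟨ cong (λ z → sum 𝟙G ℤ.+ z) (∑-δ-* u (sum 𝟙H)) ⟩
    sum 𝟙G ℤ.+ sum 𝟙H
      ≡˘⟨ cong₂ ℤ._+_ (sideDeg≡∑ G sG u) (sideDeg≡∑ H sH u′) ⟩
    + sideDeg G sG u ℤ.+ + sideDeg H sH u′ ∎)
    where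
    u : Fin (n G)
    u = proj₁ (remQuot {n G} (n H) x)
    u′ : Fin (n H)
    u′ = proj₂ (remQuot {n G} (n H) x)
    adjSameSide-at : Fin (n G) × Fin (n H) → Bool
    adjSameSide-at q = pairAdj G H (u , u′) q ∧ ⌊ productSide q ≟ᵇ productSide (u , u′) ⌋
    𝟙G : Fin (n G) → ℤ
    𝟙G = 𝟙 ∘ adjSameSide G sG u
    𝟙H : Fin (n H) → ℤ
    𝟙H = 𝟙 ∘ adjSameSide H sH u′

  productPartition-valid : ∀ {k ℓ} → Valid G k sG → Valid H ℓ sH →
    Valid (G □ H) (k + ℓ) productPartition
  productPartition-valid validG validH x rewrite sideDeg-productPartition x =
    +-mono-≤ (validG (proj₁ (remQuot {n G} (n H) x))) (validH (proj₂ (remQuot {n G} (n H) x)))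

lemma5p2 : (G H : Graph) (k ℓ : ℕ) (ιG ιH : ℤ) →
    IsImbalance G k ιG → IsImbalance H ℓ ιH →
    Σ ℤ (λ ιGH → IsImbalance (G □ H) (k + ℓ) ιGH × ιG * ιH ≤ ιGH)
lemma5p2 G H k ℓ ιG ιH ((sG , validG , refl) , _) ((sH , validH , refl) , _) =
  let valid = productPartition-valid G H sG sH validG validH
      (ι , isImbalance , product≤ι) = imbalance-exists (G □ H) (k + ℓ) valid
  in ι , isImbalance , subst (_≤ ι) (diff-productPartition G H sG sH) product≤ι
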